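{- For every $n\ge0$, the sum of the weights of the elements of $\mathfrak B_n$ is \[ B_n(\tilde\alpha,\tilde\beta,y,q)=\sum_{k=0}^{n}\begin{bmatrix} n\\ k\end{bmatrix}_q\tilde\alpha^k(y\tilde\beta)^{n-k}. \]
   Context: Let $\alpha,\beta,y,q$ be indeterminates, $\tilde\alpha=(1-q)\frac1\alpha-1$, $\tilde\beta=(1-q)\frac1\beta-1$. $\mathfrak B_n$ is the set of weighted Motzkin paths of length $n$ (steps $\nearrow,\rightarrow,\searrow$ from height 0 to 0, never below 0; each step carries one of its allowed weights, different choices giving different elements) such that: a step $\nearrow$ starting at height $h$ has weight $1$ or $-q^{h+1}$; a step $\rightarrow$ starting at height $h$ has weight $(\tilde\alpha+y\tilde\beta)q^h$; a step $\searrow$ starting at height $h$ has weight $-y\tilde\alpha\tilde\beta q^{h-1}$. The weight of a path is the product of its step weights. $\begin{bmatrix} n\\ k\end{bmatrix}_q$ is the Gaussian binomial coefficient. -}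

module Defs where

open import Level using (Level)
open import Data.Nat using (ℕ; zero; suc)
open import Data.Bool using (Bool; true; false)
open import Data.List using (List; []; _∷_; map; concatMap; foldr; length)
open import Algebra.Bundles using (CommutativeRing)

-- Step choices of a weighted Motzkin path.  An up step carries one of two
-- weights (1 or -q^{h+1}); these are distinct elements of 𝔅ₙ.
data Step : Set where
  up₁  : Step
  up₋  : Step
  flat : Step
  down : Step

allSteps : List Step
allSteps = up₁ ∷ up₋ ∷ flat ∷ down ∷ []

words : ℕ → List (List Step)
words zero    = [] ∷ []
words (suc n) = concatMap (λ s → map (s ∷_) (words n)) allSteps

validFrom : ℕ → List Step → Bool
validFrom zero    []          = true
validFrom (suc h) []          = false
validFrom h       (up₁ ∷ w)   = validFrom (suc h) w
validFrom h       (up₋ ∷ w)   = validFrom (suc h) w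
validFrom h       (flat ∷ w)  = validFrom h w
validFrom zero    (down ∷ w)  = false
validFrom (suc h) (down ∷ w)  = validFrom h w

filterB : {A : Set} → (A → Bool) → List A → List A
filterB p []       = []
filterB p (x ∷ xs) with p x
... | true  = x ∷ filterB p xs
... | false = filterB p xs

𝔅 : ℕ → List (List Step)
𝔅 n = filterB (validFrom 0) (words n)

module _ {c ℓ : Level} (R : CommutativeRing c ℓ) where
  open CommutativeRing R

  pow : Carrier → ℕ → Carrier
  pow x zero    = 1#
  pow x (suc k) = x * pow x k

  weightFrom : (ã b̃ y q : Carrier) → ℕ → List Step → Carrier
  weightFrom ã b̃ y q h       []         = 1#
  weightFrom ã b̃ y q h       (up₁ ∷ w)  = 1# * weightFrom ã b̃ y q (suc h) w
  weightFrom ã b̃ y q h       (up₋ ∷ w)  = (- pow q (suc h)) * weightFrom ã b̃ y q (suc h) w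
  weightFrom ã b̃ y q h       (flat ∷ w) = ((ã + y * b̃) * pow q h) * weightFrom ã b̃ y q h w
  weightFrom ã b̃ y q zero    (down ∷ w) = 0#  -- never occurs in a valid path
  weightFrom ã b̃ y q (suc h) (down ∷ w) = (- (y * ã * b̃ * pow q h)) * weightFrom ã b̃ y q h w

  sumR : List Carrier → Carrier
  sumR = foldr _+_ 0#

  totalWeight : (ã b̃ y q : Carrier) → ℕ → Carrier
  totalWeight ã b̃ y q n = sumR (map (weightFrom ã b̃ y q 0) (𝔅 n))

  gbinom : Carrier → ℕ → ℕ → Carrier
  gbinom q zero    zero    = 1#
  gbinom q zero    (suc k) = 0#
  gbinom q (suc n) zero    = 1#
  gbinom q (suc n) (suc k) = gbinom q n k + pow q (suc k) * gbinom q n (suc k)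

  sumTo : ℕ → (ℕ → Carrier) → Carrier
  sumTo zero    f = f 0
  sumTo (suc m) f = sumTo m f + f (suc m)

  Bpoly : (ã b̃ y q : Carrier) → ℕ → Carrier
  Bpoly ã b̃ y q n = sumTo n (λ k → gbinom q n k * pow ã k * pow (y * b̃) (n Data.Nat.∸ k))

-- A path of length n + 1 from height h starts with an up step (weight 1 or -q^(h+1)), a flat
-- step or a down step, so the weight sum P(n, h) of paths from height h down to 0 obeys a
-- transfer-matrix recurrence in n.  That recurrence is solved by
--   P(n, h) = D(h) [n, h]_q H(n - h),
-- where D(h) is the weight of h consecutive down steps ending at height 0 and
-- H(m) = Σ_k [m, k]_q ã^k (y b̃)^(m-k) is a homogeneous Rogers–Szegő polynomial.  Checking
-- this uses only q-Pascal, the ratio (1 - q^(k+1)) [n, k+1] = (1 - q^(n-k)) [n, k] and the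
-- three-term recurrence H(m+1) = (ã + y b̃) H(m) - ã y b̃ (1 - q^m) H(m-1); at h = 0 it is B_n.
module Submission where

open import Defs
open import Level using (Level)
open import Algebra.Bundles using (CommutativeRing)
open import Algebra.Solver.Ring.AlmostCommutativeRing using (_-Raw-AlmostCommutative⟶_; fromCommutativeRing)
import Algebra.Solver.Ring as RingSolver
import Algebra.Properties.CommutativeSemigroup as CommutativeSemigroupProperties
import Algebra.Properties.Ring as RingProperties
import Algebra.Properties.Semiring.Mult.TCOptimised as SemiringMultProperties
open import Data.Bool.Base using (Bool; true; false)
open import Data.Integer.Base as ℤ using (ℤ; +_; -[1+_]; _⊖_; _◃_; sign; ∣_∣)
open import Data.Integer.Properties as ℤ using ([1+m]⊖[1+n]≡m⊖n; ◃-inverse)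
open import Data.List.Base using (List; []; _∷_; _++_; map)
open import Data.Maybe.Base using (Maybe; just; nothing)
open import Data.Nat.Base as ℕ using (ℕ; zero; suc; pred; _∸_; _≤_; _<_)
open import Data.Nat.Properties as ℕ
  using (_≤?_; ≰⇒>; m<n⇒m<1+n; n<1+n; +-suc; +-∸-assoc; m+[n∸m]≡n; pred[m∸n]≡m∸[1+n])
open import Data.Sign.Base as Sign using (Sign)
open import Function.Base using (_∘_)
open import Relation.Binary.PropositionalEquality as ≡ using (_≡_)
open import Relation.Nullary.Decidable using (yes; no)

-- Algebra.Solver.Ring needs coefficients with decidable equality; ℤ maps into every
-- commutative ring, so integer coefficients make the solver usable for an arbitrary R.
module IntegerCoefficients {r ℓ : Level} (R : CommutativeRing r ℓ) where
  open CommutativeRing R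
  open RingProperties ring using (-0#≈0#; -‿involutive; -‿+-comm; -1*x≈-x)
  open SemiringMultProperties semiring using (_×_; ×-homo-+; ×1-homo-*; 1+×)
  open CommutativeSemigroupProperties +-commutativeSemigroup using () renaming (interchange to +-interchange)
  open CommutativeSemigroupProperties *-commutativeSemigroup using () renaming (interchange to *-interchange)
  open import Relation.Binary.Reasoning.Setoid setoid

  fromℤ : ℤ → Carrier
  fromℤ (+ n)    = n × 1#
  fromℤ -[1+ n ] = - (suc n × 1#)

  fromSign : Sign → Carrier
  fromSign Sign.+ = 1#
  fromSign Sign.- = - 1#

  ⊖-homo : ∀ m n → fromℤ (m ⊖ n) ≈ m × 1# - n × 1#
  ⊖-homo zero    zero    = sym (-‿inverseʳ 0#)
  ⊖-homo zero    (suc n) = sym (+-identityˡ _)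
  ⊖-homo (suc m) zero    = sym (trans (+-congˡ -0#≈0#) (+-identityʳ _))
  ⊖-homo (suc m) (suc n) = begin
    fromℤ (suc m ⊖ suc n)            ≡⟨ ≡.cong fromℤ ([1+m]⊖[1+n]≡m⊖n m n) ⟩
    fromℤ (m ⊖ n)                    ≈⟨ ⊖-homo m n ⟩
    m × 1# - n × 1#                  ≈⟨ +-identityˡ _ ⟨
    0# + (m × 1# - n × 1#)           ≈⟨ +-congʳ (-‿inverseʳ 1#) ⟨
    (1# - 1#) + (m × 1# - n × 1#)    ≈⟨ +-interchange 1# (- 1#) (m × 1#) (- (n × 1#)) ⟩
    (1# + m × 1#) + (- 1# - n × 1#)  ≈⟨ +-congˡ (-‿+-comm 1# (n × 1#)) ⟩
    (1# + m × 1#) - (1# + n × 1#)    ≈⟨ +-cong (1+× m 1#) (-‿cong (1+× n 1#)) ⟨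
    suc m × 1# - suc n × 1#          ∎

  fromSign-homo : ∀ s t → fromSign (s Sign.* t) ≈ fromSign s * fromSign t
  fromSign-homo Sign.+ t      = sym (*-identityˡ _)
  fromSign-homo Sign.- Sign.+ = sym (*-identityʳ _)
  fromSign-homo Sign.- Sign.- = sym (trans (-1*x≈-x (- 1#)) (-‿involutive 1#))

  ◃-homo : ∀ s n → fromℤ (s ◃ n) ≈ fromSign s * (n × 1#)
  ◃-homo s      zero    = sym (zeroʳ _)
  ◃-homo Sign.+ (suc n) = sym (*-identityˡ _)
  ◃-homo Sign.- (suc n) = sym (-1*x≈-x _)

  fromℤ-sign-abs : ∀ i → fromℤ i ≈ fromSign (sign i) * (∣ i ∣ × 1#)
  fromℤ-sign-abs i = trans (reflexive (≡.cong fromℤ (≡.sym (◃-inverse i)))) (◃-homo (sign i) ∣ i ∣)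

  +-homo : ∀ i j → fromℤ (i ℤ.+ j) ≈ fromℤ i + fromℤ j
  +-homo (+ m)    (+ n)    = ×-homo-+ 1# m n
  +-homo (+ m)    -[1+ n ] = ⊖-homo m (suc n)
  +-homo -[1+ m ] (+ n)    = trans (⊖-homo n (suc m)) (+-comm _ _)
  +-homo -[1+ m ] -[1+ n ] = begin
    - (suc (suc (m ℕ.+ n)) × 1#)  ≡⟨ ≡.cong (λ k → - (suc k × 1#)) (+-suc m n) ⟨
    - ((suc m ℕ.+ suc n) × 1#)    ≈⟨ -‿cong (×-homo-+ 1# (suc m) (suc n)) ⟩
    - (suc m × 1# + suc n × 1#)   ≈⟨ -‿+-comm _ _ ⟨
    - (suc m × 1#) - suc n × 1#   ∎

  *-homo : ∀ i j → fromℤ (i ℤ.* j) ≈ fromℤ i * fromℤ j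
  *-homo i j = begin
    fromℤ (s ◃ ∣ i ∣ ℕ.* ∣ j ∣)                    ≈⟨ ◃-homo s (∣ i ∣ ℕ.* ∣ j ∣) ⟩
    fromSign s * ((∣ i ∣ ℕ.* ∣ j ∣) × 1#)          ≈⟨ *-cong (fromSign-homo (sign i) (sign j)) (×1-homo-* ∣ i ∣ ∣ j ∣) ⟩
    (fromSign (sign i) * fromSign (sign j)) * ((∣ i ∣ × 1#) * (∣ j ∣ × 1#))
                                                   ≈⟨ *-interchange _ _ _ _ ⟩
    (fromSign (sign i) * (∣ i ∣ × 1#)) * (fromSign (sign j) * (∣ j ∣ × 1#))
                                                   ≈⟨ *-cong (fromℤ-sign-abs i) (fromℤ-sign-abs j) ⟨
    fromℤ i * fromℤ j                              ∎
    where s = sign i Sign.* sign j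

  -‿homo : ∀ i → fromℤ (ℤ.- i) ≈ - fromℤ i
  -‿homo -[1+ n ]    = sym (-‿involutive _)
  -‿homo (+ zero)    = sym -0#≈0#
  -‿homo (+ (suc n)) = refl

  fromℤ-homomorphism : ℤ.+-*-rawRing -Raw-AlmostCommutative⟶ fromCommutativeRing R
  fromℤ-homomorphism = record
    { ⟦_⟧    = fromℤ
    ; +-homo = +-homo
    ; *-homo = *-homo
    ; -‿homo = -‿homo
    ; 0-homo = refl
    ; 1-homo = refl
    }

  fromℤ-≟ : ∀ i j → Maybe (fromℤ i ≈ fromℤ j)
  fromℤ-≟ i j with i ℤ.≟ j
  ... | yes ≡.refl = just refl
  ... | no _       = nothing

  open RingSolver ℤ.+-*-rawRing (fromCommutativeRing R) fromℤ-homomorphism fromℤ-≟ public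

module _ {r ℓ : Level} (R : CommutativeRing r ℓ) where
  open CommutativeRing R
  open IntegerCoefficients R using (solve; _:=_; _:+_; _:-_; _:*_; :-_; con; Polynomial)
  open CommutativeSemigroupProperties +-commutativeSemigroup using () renaming (interchange to +-interchange)
  open import Relation.Binary.Reasoning.Setoid setoid

  1ₚ 0ₚ : ∀ {n} → Polynomial n
  1ₚ = con (+ 1)
  0ₚ = con (+ 0)

  infixr 8 _^_
  _^_ : Carrier → ℕ → Carrier
  _^_ = pow R

  ^-homo-* : ∀ x m n → x ^ (m ℕ.+ n) ≈ x ^ m * x ^ n
  ^-homo-* x zero    n = sym (*-identityˡ _)
  ^-homo-* x (suc m) n = trans (*-congˡ (^-homo-* x m n)) (sym (*-assoc _ _ _))

  sumTo-cong : ∀ m {f g : ℕ → Carrier} → (∀ k → f k ≈ g k) → sumTo R m f ≈ sumTo R m g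
  sumTo-cong zero    f≈g = f≈g 0
  sumTo-cong (suc m) f≈g = +-cong (sumTo-cong m f≈g) (f≈g (suc m))

  sumTo-+ : ∀ m (f g : ℕ → Carrier) → sumTo R m (λ k → f k + g k) ≈ sumTo R m f + sumTo R m g
  sumTo-+ zero    f g = refl
  sumTo-+ (suc m) f g = trans (+-congʳ (sumTo-+ m f g)) (+-interchange _ _ _ _)

  sumTo-*ˡ : ∀ m x (f : ℕ → Carrier) → sumTo R m (λ k → x * f k) ≈ x * sumTo R m f
  sumTo-*ˡ zero    x f = refl
  sumTo-*ˡ (suc m) x f = trans (+-congʳ (sumTo-*ˡ m x f)) (sym (distribˡ x _ _))

  sumTo-sucˡ : ∀ m (f : ℕ → Carrier) → sumTo R (suc m) f ≈ f 0 + sumTo R m (f ∘ suc)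
  sumTo-sucˡ zero    f = refl
  sumTo-sucˡ (suc m) f = trans (+-congʳ (sumTo-sucˡ m f)) (+-assoc _ _ _)

  filteredSum : {A : Set} → (A → Bool) → (A → Carrier) → List A → Carrier
  filteredSum p f xs = sumR R (map f (filterB p xs))

  filteredSum-++ : ∀ {A : Set} (p : A → Bool) (f : A → Carrier) xs ys →
                   filteredSum p f (xs ++ ys) ≈ filteredSum p f xs + filteredSum p f ys
  filteredSum-++ p f []       ys = sym (+-identityˡ _)
  filteredSum-++ p f (x ∷ xs) ys with p x
  ... | true  = trans (+-congˡ (filteredSum-++ p f xs ys)) (sym (+-assoc _ _ _))
  ... | false = filteredSum-++ p f xs ys

  filteredSum-map-∷ : ∀ {A : Set} (p p′ : List A → Bool) (f f′ : List A → Carrier) s k →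
                      (∀ w → p (s ∷ w) ≡ p′ w) → (∀ w → f (s ∷ w) ≈ k * f′ w) → ∀ ws →
                      filteredSum p f (map (s ∷_) ws) ≈ k * filteredSum p′ f′ ws
  filteredSum-map-∷ p p′ f f′ s k p≡p′ f≈kf′ []       = sym (zeroʳ k)
  filteredSum-map-∷ p p′ f f′ s k p≡p′ f≈kf′ (w ∷ ws) rewrite p≡p′ w with p′ w
  ... | true  = trans (+-cong (f≈kf′ w) (filteredSum-map-∷ p p′ f f′ s k p≡p′ f≈kf′ ws)) (sym (distribˡ k _ _))
  ... | false = filteredSum-map-∷ p p′ f f′ s k p≡p′ f≈kf′ ws

  filteredSum-map-∷-rejected : ∀ {A : Set} (p : List A → Bool) (f : List A → Carrier) s →
                               (∀ w → p (s ∷ w) ≡ false) → ∀ ws → filteredSum p f (map (s ∷_) ws) ≈ 0#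
  filteredSum-map-∷-rejected p f s rejected []       = refl
  filteredSum-map-∷-rejected p f s rejected (w ∷ ws) rewrite rejected w =
    filteredSum-map-∷-rejected p f s rejected ws

  module _ (q : Carrier) where

    [_,_] : ℕ → ℕ → Carrier
    [ n , k ] = gbinom R q n k

    gbinom-zeroʳ : ∀ n → [ n , 0 ] ≡ 1#
    gbinom-zeroʳ zero    = ≡.refl
    gbinom-zeroʳ (suc n) = ≡.refl

    gbinom-vanishes : ∀ {n k} → n < k → [ n , k ] ≈ 0#
    gbinom-vanishes {zero}  {suc k} _           = refl
    gbinom-vanishes {suc n} {suc k} (ℕ.s≤s n<k) = trans
      (+-cong (gbinom-vanishes n<k) (trans (*-congˡ (gbinom-vanishes (m<n⇒m<1+n n<k))) (zeroʳ _)))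
      (+-identityʳ 0#)

    gbinom-support : ∀ n k {x y} → (k ≤ n → x ≈ y) → [ n , k ] * x ≈ [ n , k ] * y
    gbinom-support n k {x} {y} x≈y with k ≤? n
    ... | yes k≤n = *-congˡ (x≈y k≤n)
    ... | no  k≰n = trans (vanish x) (sym (vanish y))
      where vanish = λ z → trans (*-congʳ (gbinom-vanishes (≰⇒> k≰n))) (zeroˡ z)

    gbinom-∸-suc : ∀ (f : ℕ → Carrier) n k → [ n , suc k ] * f (n ∸ k) ≈ [ n , suc k ] * f (suc (n ∸ suc k))
    gbinom-∸-suc f n k = gbinom-support n (suc k) (λ k<n → reflexive (≡.cong f (+-∸-assoc 1 k<n)))

    gbinom-ratio : ∀ n k → (1# - q ^ suc k) * [ n , suc k ] ≈ (1# - q ^ (n ∸ k)) * [ n , k ]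
    gbinom-ratio zero    zero    = solve 1 (λ q → (1ₚ :- q :* 1ₚ) :* 0ₚ := (1ₚ :- 1ₚ) :* 1ₚ) refl q
    gbinom-ratio zero    (suc k) = trans (zeroʳ _) (sym (zeroʳ _))
    gbinom-ratio (suc n) zero    = begin
      (1# - q * 1#) * ([ n , 0 ] + q * 1# * [ n , 1 ])
        ≡⟨ ≡.cong (λ b → (1# - q * 1#) * (b + q * 1# * [ n , 1 ])) (gbinom-zeroʳ n) ⟩
      (1# - q * 1#) * (1# + q * 1# * [ n , 1 ])
        ≈⟨ solve 2 (λ q B → (1ₚ :- q :* 1ₚ) :* (1ₚ :+ q :* 1ₚ :* B) := 1ₚ :- q :+ q :* ((1ₚ :- q :* 1ₚ) :* B))
                   refl q [ n , 1 ] ⟩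
      1# - q + q * ((1# - q * 1#) * [ n , 1 ])
        ≈⟨ +-congˡ (*-congˡ (gbinom-ratio n 0)) ⟩
      1# - q + q * ((1# - q ^ n) * [ n , 0 ])
        ≡⟨ ≡.cong (λ b → 1# - q + q * ((1# - q ^ n) * b)) (gbinom-zeroʳ n) ⟩
      1# - q + q * ((1# - q ^ n) * 1#)
        ≈⟨ solve 2 (λ q Q → 1ₚ :- q :+ q :* ((1ₚ :- Q) :* 1ₚ) := (1ₚ :- q :* Q) :* 1ₚ) refl q (q ^ n) ⟩
      (1# - q ^ suc n) * 1# ∎
    gbinom-ratio (suc n) (suc k) = begin
      (1# - q * Q) * (B₁ + q * Q * B₂)
        ≈⟨ solve 4 (λ q Q B₁ B₂ → (1ₚ :- q :* Q) :* (B₁ :+ q :* Q :* B₂)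
                                := (1ₚ :- q :* Q) :* B₁ :+ q :* Q :* ((1ₚ :- q :* Q) :* B₂))
                   refl q Q B₁ B₂ ⟩
      (1# - q * Q) * B₁ + q * Q * ((1# - q * Q) * B₂)
        ≈⟨ +-congˡ (*-congˡ (gbinom-ratio n (suc k))) ⟩
      (1# - q * Q) * B₁ + q * Q * ((1# - q ^ (n ∸ suc k)) * B₁)
        ≈⟨ solve 4 (λ q Q E B₁ → (1ₚ :- q :* Q) :* B₁ :+ q :* Q :* ((1ₚ :- E) :* B₁) := B₁ :* (1ₚ :- Q :* (q :* E)))
                   refl q Q (q ^ (n ∸ suc k)) B₁ ⟩
      B₁ * (1# - Q * q ^ suc (n ∸ suc k))
        ≈⟨ gbinom-∸-suc (λ i → 1# - Q * q ^ i) n k ⟨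
      B₁ * (1# - Q * q ^ (n ∸ k))
        ≈⟨ solve 3 (λ Q E B₁ → B₁ :* (1ₚ :- Q :* E) := (1ₚ :- Q) :* B₁ :+ Q :* ((1ₚ :- E) :* B₁))
                   refl Q (q ^ (n ∸ k)) B₁ ⟩
      (1# - Q) * B₁ + Q * ((1# - q ^ (n ∸ k)) * B₁)
        ≈⟨ +-congʳ (gbinom-ratio n k) ⟩
      (1# - q ^ (n ∸ k)) * B₀ + Q * ((1# - q ^ (n ∸ k)) * B₁)
        ≈⟨ solve 4 (λ E Q B₀ B₁ → (1ₚ :- E) :* B₀ :+ Q :* ((1ₚ :- E) :* B₁) := (1ₚ :- E) :* (B₀ :+ Q :* B₁))
                   refl (q ^ (n ∸ k)) Q B₀ B₁ ⟩
      (1# - q ^ (n ∸ k)) * (B₀ + Q * B₁) ∎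
      where
        Q  = q ^ suc k
        B₀ = [ n , k ]
        B₁ = [ n , suc k ]
        B₂ = [ n , suc (suc k) ]

    gbinom-absorption : ∀ n k → (1# - q ^ suc k) * [ suc n , suc k ] ≈ (1# - q ^ suc n) * [ n , k ]
    gbinom-absorption n k = begin
      (1# - Q) * ([ n , k ] + Q * [ n , suc k ])
        ≈⟨ solve 3 (λ Q B₀ B₁ → (1ₚ :- Q) :* (B₀ :+ Q :* B₁) := (1ₚ :- Q) :* B₀ :+ Q :* ((1ₚ :- Q) :* B₁))
                   refl Q [ n , k ] [ n , suc k ] ⟩
      (1# - Q) * [ n , k ] + Q * ((1# - Q) * [ n , suc k ])
        ≈⟨ +-congˡ (*-congˡ (gbinom-ratio n k)) ⟩
      (1# - Q) * [ n , k ] + Q * ((1# - q ^ (n ∸ k)) * [ n , k ])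
        ≈⟨ solve 3 (λ Q E B₀ → (1ₚ :- Q) :* B₀ :+ Q :* ((1ₚ :- E) :* B₀) := B₀ :* (1ₚ :- Q :* E))
                   refl Q (q ^ (n ∸ k)) [ n , k ] ⟩
      [ n , k ] * (1# - Q * q ^ (n ∸ k))
        ≈⟨ gbinom-support n k (λ k≤n → +-congˡ (-‿cong (exponents k≤n))) ⟩
      [ n , k ] * (1# - q ^ suc n)
        ≈⟨ *-comm _ _ ⟩
      (1# - q ^ suc n) * [ n , k ] ∎
      where
        Q = q ^ suc k
        exponents : k ≤ n → Q * q ^ (n ∸ k) ≈ q ^ suc n
        exponents k≤n = trans (sym (^-homo-* q (suc k) (n ∸ k)))
                              (reflexive (≡.cong (λ e → q ^ suc e) (m+[n∸m]≡n k≤n)))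

    module _ (a c : Carrier) where

      rsTerm : ℕ → ℕ → Carrier
      rsTerm m k = [ m , k ] * a ^ k * c ^ (m ∸ k)

      rogersSzegő : ℕ → Carrier
      rogersSzegő m = sumTo R m (rsTerm m)

      rogersSzegő-suc : ∀ m → rogersSzegő (suc m) ≈ a * rogersSzegő m + c * sumTo R m (λ k → q ^ k * rsTerm m k)
      rogersSzegő-suc m = begin
        rogersSzegő (suc m)
          ≈⟨ sumTo-sucˡ m (rsTerm (suc m)) ⟩
        rsTerm (suc m) 0 + sumTo R m (rsTerm (suc m) ∘ suc)
          ≈⟨ +-cong first (sumTo-cong m pascal) ⟩
        c * qTerm 0 + sumTo R m (λ j → a * rsTerm m j + c * qTerm (suc j))
          ≈⟨ +-congˡ (trans (sumTo-+ m _ _) (+-cong (sumTo-*ˡ m a (rsTerm m)) (sumTo-*ˡ m c (qTerm ∘ suc)))) ⟩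
        c * qTerm 0 + (a * rogersSzegő m + c * sumTo R m (qTerm ∘ suc))
          ≈⟨ solve 4 (λ c X Y Z → c :* X :+ (Y :+ c :* Z) := Y :+ c :* (X :+ Z)) refl c (qTerm 0) (a * rogersSzegő m) _ ⟩
        a * rogersSzegő m + c * (qTerm 0 + sumTo R m (qTerm ∘ suc))
          ≈⟨ +-congˡ (*-congˡ (sumTo-sucˡ m qTerm)) ⟨
        a * rogersSzegő m + c * (sumTo R m qTerm + qTerm (suc m))
          ≈⟨ +-congˡ (*-congˡ (trans (+-congˡ last) (+-identityʳ _))) ⟩
        a * rogersSzegő m + c * sumTo R m qTerm ∎
        where
          qTerm : ℕ → Carrier
          qTerm k = q ^ k * rsTerm m k

          first : rsTerm (suc m) 0 ≈ c * qTerm 0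
          first = begin
            1# * 1# * (c * c ^ m)
              ≈⟨ solve 2 (λ c C → 1ₚ :* 1ₚ :* (c :* C) := c :* (1ₚ :* (1ₚ :* 1ₚ :* C))) refl c (c ^ m) ⟩
            c * (1# * (1# * 1# * c ^ m))
              ≡⟨ ≡.cong (λ b → c * (1# * (b * 1# * c ^ m))) (gbinom-zeroʳ m) ⟨
            c * qTerm 0 ∎

          pascal : ∀ j → rsTerm (suc m) (suc j) ≈ a * rsTerm m j + c * qTerm (suc j)
          pascal j = begin
            ([ m , j ] + Q * B) * (a * a ^ j) * c ^ (m ∸ j)
              ≈⟨ solve 6 (λ A Q B a X C → (A :+ Q :* B) :* (a :* X) :* C := a :* (A :* X :* C) :+ Q :* (a :* X) :* (B :* C))
                         refl [ m , j ] Q B a (a ^ j) (c ^ (m ∸ j)) ⟩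
            a * rsTerm m j + Q * (a * a ^ j) * (B * c ^ (m ∸ j))
              ≈⟨ +-congˡ (*-congˡ (gbinom-∸-suc (c ^_) m j)) ⟩
            a * rsTerm m j + Q * (a * a ^ j) * (B * (c * c ^ (m ∸ suc j)))
              ≈⟨ +-congˡ (solve 6 (λ Q a X B c C → Q :* (a :* X) :* (B :* (c :* C)) := c :* (Q :* (B :* (a :* X) :* C)))
                                  refl Q a (a ^ j) B c (c ^ (m ∸ suc j))) ⟩
            a * rsTerm m j + c * qTerm (suc j) ∎
            where
              Q = q ^ suc j
              B = [ m , suc j ]

          last : qTerm (suc m) ≈ 0#
          last = begin
            q ^ suc m * ([ m , suc m ] * a ^ suc m * c ^ (m ∸ suc m))
              ≈⟨ *-congˡ (*-congʳ (*-congʳ (gbinom-vanishes (n<1+n m)))) ⟩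
            q ^ suc m * (0# * a ^ suc m * c ^ (m ∸ suc m))
              ≈⟨ solve 3 (λ Q X C → Q :* (0ₚ :* X :* C) := 0ₚ) refl (q ^ suc m) (a ^ suc m) (c ^ (m ∸ suc m)) ⟩
            0# ∎

      rogersSzegő-absorption : ∀ m → sumTo R m (λ k → (1# - q ^ k) * rsTerm m k) ≈ a * (1# - q ^ m) * rogersSzegő (pred m)
      rogersSzegő-absorption zero    = solve 2 (λ a T → (1ₚ :- 1ₚ) :* T := a :* (1ₚ :- 1ₚ) :* T) refl a (rsTerm 0 0)
      rogersSzegő-absorption (suc m) = begin
        sumTo R (suc m) (λ k → (1# - q ^ k) * rsTerm (suc m) k)
          ≈⟨ sumTo-sucˡ m _ ⟩
        (1# - 1#) * rsTerm (suc m) 0 + sumTo R m (λ j → (1# - q ^ suc j) * rsTerm (suc m) (suc j))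
          ≈⟨ +-cong (solve 1 (λ T → (1ₚ :- 1ₚ) :* T := 0ₚ) refl _) (sumTo-cong m absorb) ⟩
        0# + sumTo R m (λ j → a * (1# - q ^ suc m) * rsTerm m j)
          ≈⟨ trans (+-identityˡ _) (sumTo-*ˡ m _ (rsTerm m)) ⟩
        a * (1# - q ^ suc m) * rogersSzegő m ∎
        where
          absorb : ∀ j → (1# - q ^ suc j) * rsTerm (suc m) (suc j) ≈ a * (1# - q ^ suc m) * rsTerm m j
          absorb j = begin
            (1# - q ^ suc j) * ([ suc m , suc j ] * (a * a ^ j) * c ^ (m ∸ j))
              ≈⟨ solve 5 (λ E B a X C → E :* (B :* (a :* X) :* C) := E :* B :* (a :* (X :* C)))
                         refl _ _ a (a ^ j) (c ^ (m ∸ j)) ⟩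
            (1# - q ^ suc j) * [ suc m , suc j ] * (a * (a ^ j * c ^ (m ∸ j)))
              ≈⟨ *-congʳ (gbinom-absorption m j) ⟩
            (1# - q ^ suc m) * [ m , j ] * (a * (a ^ j * c ^ (m ∸ j)))
              ≈⟨ solve 5 (λ E B a X C → E :* B :* (a :* (X :* C)) := a :* E :* (B :* X :* C))
                         refl _ _ a (a ^ j) (c ^ (m ∸ j)) ⟩
            a * (1# - q ^ suc m) * rsTerm m j ∎

      -- At m = 0 the last term carries the factor 1 - q ^ 0 = 0, so pred 0 = 0 is harmless.
      rogersSzegő-recurrence : ∀ m → rogersSzegő (suc m) ≈
                                     (a + c) * rogersSzegő m - a * c * ((1# - q ^ m) * rogersSzegő (pred m))
      rogersSzegő-recurrence m = begin
        rogersSzegő (suc m)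
          ≈⟨ rogersSzegő-suc m ⟩
        a * H + c * sumTo R m (λ k → q ^ k * rsTerm m k)
          ≈⟨ +-congˡ (*-congˡ (sumTo-cong m (λ k → solve 2 (λ Q T → Q :* T := T :+ :- 1ₚ :* ((1ₚ :- Q) :* T))
                                                           refl (q ^ k) (rsTerm m k)))) ⟩
        a * H + c * sumTo R m (λ k → rsTerm m k + - 1# * ((1# - q ^ k) * rsTerm m k))
          ≈⟨ +-congˡ (*-congˡ (trans (sumTo-+ m _ _) (+-congˡ (trans (sumTo-*ˡ m _ _) (*-congˡ (rogersSzegő-absorption m)))))) ⟩
        a * H + c * (H + - 1# * (a * (1# - q ^ m) * H′))
          ≈⟨ solve 5 (λ a c H E H′ → a :* H :+ c :* (H :+ :- 1ₚ :* (a :* (1ₚ :- E) :* H′))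
                                  := (a :+ c) :* H :- a :* c :* ((1ₚ :- E) :* H′))
                     refl a c H (q ^ m) H′ ⟩
        (a + c) * H - a * c * ((1# - q ^ m) * H′) ∎
        where
          H  = rogersSzegő m
          H′ = rogersSzegő (pred m)

    module _ (ã b̃ y : Carrier) where

      pathSum : ℕ → ℕ → Carrier
      pathSum n h = filteredSum (validFrom h) (weightFrom R ã b̃ y q h) (words n)

      downSum : ℕ → ℕ → Carrier
      downSum n zero    = 0#
      downSum n (suc h) = - (y * ã * b̃ * q ^ h) * pathSum n h

      validFrom-up₁ : ∀ h w → validFrom h (up₁ ∷ w) ≡ validFrom (suc h) w
      validFrom-up₁ zero    w = ≡.refl
      validFrom-up₁ (suc h) w = ≡.refl

      validFrom-up₋ : ∀ h w → validFrom h (up₋ ∷ w) ≡ validFrom (suc h) w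
      validFrom-up₋ zero    w = ≡.refl
      validFrom-up₋ (suc h) w = ≡.refl

      validFrom-flat : ∀ h w → validFrom h (flat ∷ w) ≡ validFrom h w
      validFrom-flat zero    w = ≡.refl
      validFrom-flat (suc h) w = ≡.refl

      pathSum-suc : ∀ n h → pathSum (suc n) h ≈
                            (1# - q ^ suc h) * pathSum n (suc h) + (ã + y * b̃) * q ^ h * pathSum n h + downSum n h
      pathSum-suc n h = begin
        pathSum (suc n) h
          ≈⟨ trans (Σ-++ (starting up₁) _) (+-congˡ (trans (Σ-++ (starting up₋) _)
               (+-congˡ (trans (Σ-++ (starting flat) _) (+-congˡ (Σ-++ (starting down) [])))))) ⟩
        Σ (starting up₁) + (Σ (starting up₋) + (Σ (starting flat) + (Σ (starting down) + 0#)))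
          ≈⟨ +-cong (step up₁ (validFrom-up₁ h) (λ _ → refl))
                    (+-cong (step up₋ (validFrom-up₋ h) (λ _ → refl))
                            (+-cong (step flat (validFrom-flat h) (λ _ → refl)) (+-congʳ (downStep h)))) ⟩
        1# * U + (- q ^ suc h * U + ((ã + y * b̃) * q ^ h * P + (downSum n h + 0#)))
          ≈⟨ solve 5 (λ Q U F P D → 1ₚ :* U :+ (:- Q :* U :+ (F :* P :+ (D :+ 0ₚ))) := (1ₚ :- Q) :* U :+ F :* P :+ D)
                     refl (q ^ suc h) U _ P (downSum n h) ⟩
        (1# - q ^ suc h) * U + (ã + y * b̃) * q ^ h * P + downSum n h ∎
        where
          U = pathSum n (suc h)
          P = pathSum n h

          W : ℕ → List Step → Carrier
          W = weightFrom R ã b̃ y q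

          Σ : List (List Step) → Carrier
          Σ = filteredSum (validFrom h) (W h)

          Σ-++ = filteredSum-++ (validFrom h) (W h)

          starting : Step → List (List Step)
          starting s = map (s ∷_) (words n)

          step : ∀ s {h′ k} → (∀ w → validFrom h (s ∷ w) ≡ validFrom h′ w) → (∀ w → W h (s ∷ w) ≈ k * W h′ w) →
                 Σ (starting s) ≈ k * pathSum n h′
          step s valid weight = filteredSum-map-∷ _ _ _ _ s _ valid weight (words n)

          downStep : ∀ h → filteredSum (validFrom h) (W h) (starting down) ≈ downSum n h
          downStep zero    = filteredSum-map-∷-rejected _ _ down (λ _ → ≡.refl) (words n)
          downStep (suc h) = filteredSum-map-∷ _ _ _ _ down _ (λ _ → ≡.refl) (λ _ → refl) (words n)

      descentWeight : ℕ → Carrier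
      descentWeight zero    = 1#
      descentWeight (suc h) = - (y * ã * b̃ * q ^ h) * descentWeight h

      H : ℕ → Carrier
      H = rogersSzegő ã (y * b̃)

      closedForm : ℕ → ℕ → Carrier
      closedForm n h = descentWeight h * ([ n , h ] * H (n ∸ h))

      closedForm-climb : ∀ n h → (1# - q ^ suc h) * closedForm n (suc h) + (ã + y * b̃) * q ^ h * closedForm n h ≈
                                 descentWeight h * (q ^ h * [ n , h ] * H (suc (n ∸ h)))
      closedForm-climb n h = begin
        (1# - q ^ suc h) * (- (y * ã * b̃ * Q) * D * ([ n , suc h ] * H (n ∸ suc h))) + (ã + y * b̃) * Q * (D * ([ n , h ] * H m))
          ≈⟨ solve 10 (λ y a b Q Q₁ D B₁ H₁ B₀ Hm →
                  (1ₚ :- Q₁) :* (:- (y :* a :* b :* Q) :* D :* (B₁ :* H₁)) :+ (a :+ y :* b) :* Q :* (D :* (B₀ :* Hm))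
               := :- (y :* a :* b :* Q) :* D :* ((1ₚ :- Q₁) :* B₁ :* H₁) :+ (a :+ y :* b) :* Q :* (D :* (B₀ :* Hm)))
               refl y ã b̃ Q (q ^ suc h) D [ n , suc h ] (H (n ∸ suc h)) [ n , h ] (H m) ⟩
        - (y * ã * b̃ * Q) * D * ((1# - q ^ suc h) * [ n , suc h ] * H (n ∸ suc h)) + (ã + y * b̃) * Q * (D * ([ n , h ] * H m))
          ≈⟨ +-congʳ (*-congˡ (*-cong (gbinom-ratio n h) (reflexive (≡.cong H (≡.sym (pred[m∸n]≡m∸[1+n] n h)))))) ⟩
        - (y * ã * b̃ * Q) * D * ((1# - q ^ m) * [ n , h ] * H (pred m)) + (ã + y * b̃) * Q * (D * ([ n , h ] * H m))
          ≈⟨ solve 9 (λ y a b Q D E B₀ H′ Hm →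
                  :- (y :* a :* b :* Q) :* D :* ((1ₚ :- E) :* B₀ :* H′) :+ (a :+ y :* b) :* Q :* (D :* (B₀ :* Hm))
               := D :* (Q :* B₀ :* ((a :+ y :* b) :* Hm :- a :* (y :* b) :* ((1ₚ :- E) :* H′))))
               refl y ã b̃ Q D (q ^ m) [ n , h ] (H (pred m)) (H m) ⟩
        D * (Q * [ n , h ] * ((ã + y * b̃) * H m - ã * (y * b̃) * ((1# - q ^ m) * H (pred m))))
          ≈⟨ *-congˡ (*-congˡ (rogersSzegő-recurrence ã (y * b̃) m)) ⟨
        D * (Q * [ n , h ] * H (suc m)) ∎
        where
          Q = q ^ h
          D = descentWeight h
          m = n ∸ h

      closedForm-pascal : ∀ n k → descentWeight (suc k) * (q ^ suc k * [ n , suc k ] * H (suc (n ∸ suc k))) +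
                                  descentWeight (suc k) * ([ n , k ] * H (n ∸ k)) ≈ closedForm (suc n) (suc k)
      closedForm-pascal n k = begin
        D * (Q * [ n , suc k ] * H (suc (n ∸ suc k))) + D * ([ n , k ] * H (n ∸ k))
          ≈⟨ +-congʳ (*-congˡ (trans (*-assoc _ _ _) (*-congˡ (sym (gbinom-∸-suc H n k))))) ⟩
        D * (Q * ([ n , suc k ] * H (n ∸ k))) + D * ([ n , k ] * H (n ∸ k))
          ≈⟨ solve 5 (λ D Q B₁ B₀ Hk → D :* (Q :* (B₁ :* Hk)) :+ D :* (B₀ :* Hk) := D :* ((B₀ :+ Q :* B₁) :* Hk))
                     refl D Q [ n , suc k ] [ n , k ] (H (n ∸ k)) ⟩
        D * (([ n , k ] + Q * [ n , suc k ]) * H (n ∸ k)) ∎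
        where
          Q = q ^ suc k
          D = descentWeight (suc k)

      pathSum-closedForm : ∀ n h → pathSum n h ≈ closedForm n h
      pathSum-closedForm zero    zero    = solve 0 (1ₚ :+ 0ₚ := 1ₚ :* (1ₚ :* (1ₚ :* 1ₚ :* 1ₚ))) refl
      pathSum-closedForm zero    (suc h) = sym (trans (*-congˡ (zeroˡ _)) (zeroʳ _))
      pathSum-closedForm (suc n) h       = begin
        pathSum (suc n) h
          ≈⟨ pathSum-suc n h ⟩
        (1# - q ^ suc h) * pathSum n (suc h) + (ã + y * b̃) * q ^ h * pathSum n h + downSum n h
          ≈⟨ +-congʳ (+-cong (*-congˡ (pathSum-closedForm n (suc h))) (*-congˡ (pathSum-closedForm n h))) ⟩
        (1# - q ^ suc h) * closedForm n (suc h) + (ã + y * b̃) * q ^ h * closedForm n h + downSum n h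
          ≈⟨ +-congʳ (closedForm-climb n h) ⟩
        descentWeight h * (q ^ h * [ n , h ] * H (suc (n ∸ h))) + downSum n h
          ≈⟨ descend h ⟩
        closedForm (suc n) h ∎
        where
          descend : ∀ h → descentWeight h * (q ^ h * [ n , h ] * H (suc (n ∸ h))) + downSum n h ≈ closedForm (suc n) h
          descend zero    = begin
            1# * (1# * [ n , 0 ] * H (suc n)) + 0#
              ≡⟨ ≡.cong (λ b → 1# * (1# * b * H (suc n)) + 0#) (gbinom-zeroʳ n) ⟩
            1# * (1# * 1# * H (suc n)) + 0#
              ≈⟨ solve 1 (λ X → 1ₚ :* (1ₚ :* 1ₚ :* X) :+ 0ₚ := 1ₚ :* (1ₚ :* X)) refl (H (suc n)) ⟩
            1# * (1# * H (suc n)) ∎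
          descend (suc k) =
            trans (+-congˡ (trans (*-congˡ (pathSum-closedForm n k)) (sym (*-assoc _ _ _)))) (closedForm-pascal n k)

proposition4p5 : ∀ {c ℓ} (R : CommutativeRing c ℓ) (ã b̃ y q : CommutativeRing.Carrier R) (n : ℕ) →
    CommutativeRing._≈_ R (totalWeight R ã b̃ y q n) (Bpoly R ã b̃ y q n)
proposition4p5 R ã b̃ y q n = begin
  totalWeight R ã b̃ y q n                   ≈⟨ pathSum-closedForm R q ã b̃ y n 0 ⟩
  1# * (gbinom R q n 0 * Bpoly R ã b̃ y q n)  ≈⟨ *-identityˡ _ ⟩
  gbinom R q n 0 * Bpoly R ã b̃ y q n         ≡⟨ ≡.cong (_* Bpoly R ã b̃ y q n) (gbinom-zeroʳ R q n) ⟩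
  1# * Bpoly R ã b̃ y q n                     ≈⟨ *-identityˡ _ ⟩
  Bpoly R ã b̃ y q n                          ∎
  where
    open CommutativeRing R
    open import Relation.Binary.Reasoning.Setoid setoid
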